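{- Let $P$ be a countable poset with no infinite antichain, let $F\subseteq P$ be a strong thick chain, let $C$ be a maximal chain in $F$, and let $F=\bigcup_{x\in C}A_x$ be a partition of $F$ into antichains with $x\in A_x$ for all $x\in C$. Then there is a partition $P=\bigcup_{x\in C}B_x$ of $P$ into antichains with $A_x\subseteq B_x$ for all $x\in C$.
   Context: Write $x\parallel y$ if $x,y$ are comparable and $x\perp y$ if they are incomparable. A thick chain in $P$ is a subset $F\subseteq P$ such that every $x\in F$ is incomparable to only finitely many elements of $F$. A thick chain $F$ is strong if for every $y\in P\setminus F$ the set $\{x\in F : x\perp y \text{ and } (\forall z\in F)(z\parallel y\Rightarrow z\parallel x)\}$ is infinite. -}

module Defs where

open import Level using (0ℓ)
open import Data.Nat using (ℕ)
open import Data.Product using (Σ; ∃; _×_; _,_)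
open import Data.Sum using (_⊎_)
open import Data.List using (List)
open import Data.List.Membership.Propositional using (_∈_)
open import Relation.Nullary using (¬_)
open import Relation.Unary using (Pred; _⊆_)
open import Relation.Binary using (Rel; IsPartialOrder)
open import Relation.Binary.PropositionalEquality using (_≡_)
open import Function.Definitions using (Injective)

record PosetOn (A : Set) : Set₁ where
  field
    _≤_       : Rel A 0ℓ
    isPartial : IsPartialOrder _≡_ _≤_

Countable : Set → Set
Countable A = Σ (A → ℕ) λ f → Injective _≡_ _≡_ f

Finite : {A : Set} → Pred A 0ℓ → Set
Finite {A} S = Σ (List A) λ xs → ∀ x → S x → x ∈ xs

Infinite : {A : Set} → Pred A 0ℓ → Set
Infinite S = ¬ Finite S

module Order {A : Set} (P : PosetOn A) where
  open PosetOn P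

  _∥_ : A → A → Set
  x ∥ y = (x ≤ y) ⊎ (y ≤ x)

  _⊥_ : A → A → Set
  x ⊥ y = ¬ (x ∥ y)

  Chain : Pred A 0ℓ → Set
  Chain S = ∀ x y → S x → S y → x ∥ y

  Antichain : Pred A 0ℓ → Set
  Antichain S = ∀ x y → S x → S y → ¬ (x ≡ y) → x ⊥ y

  NoInfiniteAntichain : Set₁
  NoInfiniteAntichain = ∀ (S : Pred A 0ℓ) → Antichain S → ¬ Infinite S

  ThickChain : Pred A 0ℓ → Set
  ThickChain F = ∀ x → F x → Finite (λ y → F y × (x ⊥ y))

  StrongThickChain : Pred A 0ℓ → Set
  StrongThickChain F =
    ThickChain F ×
    (∀ y → ¬ F y →
      Infinite (λ x → F x × (x ⊥ y) × (∀ z → F z → z ∥ y → z ∥ x)))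

  MaximalChainIn : Pred A 0ℓ → Pred A 0ℓ → Set₁
  MaximalChainIn C F =
    (C ⊆ F) × Chain C ×
    (∀ (D : Pred A 0ℓ) → C ⊆ D → D ⊆ F → Chain D → D ⊆ C)

  -- S = ⋃_{x ∈ C} Part x is a partition of S into antichains, indexed by C
  -- (values of Part outside C are irrelevant).
  record AntichainPartition (S C : Pred A 0ℓ) (Part : A → Pred A 0ℓ) : Set where
    field
      inside    : ∀ x → C x → Part x ⊆ S
      covers    : ∀ y → S y → ∃ λ x → C x × Part x y
      disjoint  : ∀ x x′ y → C x → C x′ → Part x y → Part x′ y → x ≡ x′
      antichain : ∀ x → C x → Antichain (Part x)

{-# OPTIONS --safe #-}
-- Every class A_c is an antichain, hence finite. If y ∉ F and x lies in the
-- infinite set witnessing strongness for y, then the whole class of x is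
-- incomparable to y: a member comparable to y would be comparable to x.
-- Finitely many classes cover only finitely many points, so for every y ∉ F
-- infinitely many classes are incomparable to y. Enumerating P along its
-- injection into ℕ, give each y ∉ F a class not given to any earlier y and
-- add y to it; each class gains at most one point and so stays an antichain.
module Submission where

open import Defs
open import Level using (0ℓ; lift; lower)
open import Function using (id; _∘_)
open import Function.Definitions using (Injective)
open import Data.Product using (Σ; ∃; _×_; _,_; proj₁; proj₂)
open import Data.Sum using (_⊎_; inj₁; inj₂; swap)
open import Data.Unit using (⊤; tt)
open import Data.Empty using (⊥-elim)
open import Data.Nat using (ℕ; zero; suc; _<_; _≤′_; ≤′-refl; ≤′-step)
open import Data.Nat.Properties using (<-cmp; ≤⇒≤′)
open import Data.List using (List; []; _∷_; _++_)
open import Data.List.Membership.Propositional using (_∈_; _∉_)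
open import Data.List.Membership.Propositional.Properties using (∈-++⁺ˡ; ∈-++⁺ʳ)
open import Data.List.Relation.Unary.Any using (here; there)
open import Relation.Binary using (tri<; tri≈; tri>)
open import Relation.Binary.PropositionalEquality using (_≡_; _≢_; refl; sym; subst)
open import Relation.Nullary using (Dec; yes; no; ¬_; contradiction)
open import Relation.Nullary.Decidable using (map′; decidable-stable; ¬¬-excluded-middle)
open import Relation.Unary using (Pred; _⊆_)
open import Axiom.ExcludedMiddle using (ExcludedMiddle)

module _ (em : ExcludedMiddle (Level.suc 0ℓ)) where

  decide : (Q : Set) → Dec Q
  decide Q = map′ lower lift em

  stable : {Q : Set} → ¬ ¬ Q → Q
  stable = decidable-stable (decide _)

Finite-⊆ : {A : Set} {S T : Pred A 0ℓ} → S ⊆ T → Finite T → Finite S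
Finite-⊆ S⊆T (xs , T⊆xs) = xs , λ x s → T⊆xs x (S⊆T s)

Finite-⋃ : {I A : Set} (T : I → Pred A 0ℓ) → (∀ i → Finite (T i)) →
           (is : List I) → Finite (λ x → ∃ λ i → i ∈ is × T i x)
Finite-⋃ T fin []       = [] , λ { _ (_ , () , _) }
Finite-⋃ T fin (i ∷ is) = proj₁ (fin i) ++ proj₁ rest , λ where
    x (_ , here refl , t)  → ∈-++⁺ˡ (proj₂ (fin i) x t)
    x (j , there j∈is , t) → ∈-++⁺ʳ (proj₁ (fin i)) (proj₂ rest x (j , j∈is , t))
  where rest = Finite-⋃ T fin is

-- A greedy choice along the enumeration: each y in N receives a good candidate
-- outside the list of candidates already given to elements of smaller code.
module InjectiveChoice
  (decide : (Q : Set) → Dec Q) {A : Set} (enc : A → ℕ) (enc-injective : Injective _≡_ _≡_ enc)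
  (N : Pred A 0ℓ) (Good : A → A → Set)
  (fresh : ∀ y → N y → (cs : List A) → ∃ λ c → Good y c × c ∉ cs) where

  private
    pick : A → List A → A
    pick y cs with decide (N y)
    ... | yes ny = proj₁ (fresh y ny cs)
    ... | no _   = y

    pick-good-fresh : ∀ y → N y → ∀ cs → Good y (pick y cs) × pick y cs ∉ cs
    pick-good-fresh y ny cs with decide (N y)
    ... | yes ny′ = proj₂ (fresh y ny′ cs)
    ... | no ¬ny  = contradiction ny ¬ny

    used : ℕ → List A
    used zero = []
    used (suc n) with decide (∃ λ y → enc y ≡ n)
    ... | yes (y , _) = pick y (used n) ∷ used n
    ... | no _        = used n

    used-suc : ∀ n {c} → c ∈ used n → c ∈ used (suc n)
    used-suc n with decide (∃ λ y → enc y ≡ n)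
    ... | yes _ = there
    ... | no _  = id

    used-mono : ∀ {m n} → m ≤′ n → ∀ {c} → c ∈ used m → c ∈ used n
    used-mono ≤′-refl        = id
    used-mono (≤′-step m≤′n) = used-suc _ ∘ used-mono m≤′n

  choice : A → A
  choice y = pick y (used (enc y))

  private
    choice-used : ∀ y → choice y ∈ used (suc (enc y))
    choice-used y with decide (∃ λ x → enc x ≡ enc y)
    ... | yes (x , ex) with refl ← enc-injective ex = here refl
    ... | no none = contradiction (y , refl) none

    choice-fresh : ∀ x y → N y → enc x < enc y → choice x ≢ choice y
    choice-fresh x y ny ex<ey eq =
      proj₂ (pick-good-fresh y ny (used (enc y)))
        (subst (_∈ used (enc y)) eq (used-mono (≤⇒≤′ ex<ey) (choice-used x)))

  choice-good : ∀ y → N y → Good y (choice y)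
  choice-good y ny = proj₁ (pick-good-fresh y ny (used (enc y)))

  choice-injective : ∀ x y → N x → N y → choice x ≡ choice y → x ≡ y
  choice-injective x y nx ny eq with <-cmp (enc x) (enc y)
  ... | tri< lt _ _ = contradiction eq (choice-fresh x y ny lt)
  ... | tri≈ _ e _  = enc-injective e
  ... | tri> _ _ gt = contradiction (sym eq) (choice-fresh y x nx gt)

module _ {A : Set} (P : PosetOn A) where
  open Order P

  ⊥-sym : ∀ {x y} → x ⊥ y → y ⊥ x
  ⊥-sym x⊥y = x⊥y ∘ swap

  StrongWitness : Pred A 0ℓ → A → Pred A 0ℓ
  StrongWitness F y x = F x × (x ⊥ y) × (∀ z → F z → z ∥ y → z ∥ x)

  module _ {F C : Pred A 0ℓ} {Aₓ : A → Pred A 0ℓ} (AP : AntichainPartition F C Aₓ) where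
    open AntichainPartition AP

    IncomparableClass : A → A → Set
    IncomparableClass y c = C c × (∀ a → Aₓ c a → a ⊥ y)

    StrongWitness⇒IncomparableClass : ∀ {y x c} → StrongWitness F y x → C c → Aₓ c x →
                                      IncomparableClass y c
    StrongWitness⇒IncomparableClass {y} {x} {c} (_ , x⊥y , y∥⇒x∥) Cc ax =
      Cc , λ a aₓ a∥y → ¬¬-excluded-middle {A = a ≡ x} λ where
        (yes refl) → x⊥y a∥y
        (no a≢x)   → antichain c Cc a x aₓ ax a≢x (y∥⇒x∥ a (inside c Cc aₓ) a∥y)

    -- Aₓ c is unconstrained for c ∉ C, hence the guard.
    ClassIn : A → Pred A 0ℓ
    ClassIn c x = C c × Aₓ c x

    ClassIn-finite : (∀ {Q : Set} → ¬ ¬ Q → Q) → NoInfiniteAntichain → ∀ c → Finite (ClassIn c)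
    ClassIn-finite stable nia c =
      stable (nia (ClassIn c) λ x y (Cc , ax) (_ , ay) → antichain c Cc x y ax ay)

    fresh-IncomparableClass : (∀ {Q : Set} → ¬ ¬ Q → Q) → NoInfiniteAntichain →
      StrongThickChain F → ∀ y → ¬ F y → (cs : List A) → ∃ λ c → IncomparableClass y c × c ∉ cs
    fresh-IncomparableClass stable nia (_ , strong) y y∉F cs = stable λ noFresh →
      strong y y∉F (Finite-⊆ (listed noFresh) (Finite-⋃ ClassIn (ClassIn-finite stable nia) cs))
      where
      listed : ¬ (∃ λ c → IncomparableClass y c × c ∉ cs) →
               StrongWitness F y ⊆ (λ x → ∃ λ c → c ∈ cs × ClassIn c x)
      listed noFresh {x} wx with covers x (proj₁ wx)
      ... | c , Cc , ax = stable λ unlisted →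
        noFresh (c , StrongWitness⇒IncomparableClass wx Cc ax , λ c∈cs → unlisted (c , c∈cs , Cc , ax))

    extendBy : (A → A) → A → Pred A 0ℓ
    extendBy g c z = Aₓ c z ⊎ (¬ F z × g z ≡ c)

    extendBy-partition : ((Q : Set) → Dec Q) → (g : A → A) →
      (∀ y → ¬ F y → IncomparableClass y (g y)) →
      (∀ x y → ¬ F x → ¬ F y → g x ≡ g y → x ≡ y) →
      AntichainPartition (λ _ → ⊤) C (extendBy g)
    extendBy-partition decide g g-incomparable g-injective = record
      { inside    = λ _ _ _ → tt
      ; covers    = covers′
      ; disjoint  = disjoint′
      ; antichain = antichain′
      }
      where
      covers′ : ∀ y → ⊤ → ∃ λ c → C c × extendBy g c y
      covers′ y _ with decide (F y)
      ... | yes Fy = let c , Cc , ay = covers y Fy in c , Cc , inj₁ ay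
      ... | no y∉F = g y , proj₁ (g-incomparable y y∉F) , inj₂ (y∉F , refl)

      disjoint′ : ∀ c c′ y → C c → C c′ → extendBy g c y → extendBy g c′ y → c ≡ c′
      disjoint′ c c′ y Cc Cc′ (inj₁ ay)        (inj₁ a′y)        = disjoint c c′ y Cc Cc′ ay a′y
      disjoint′ c c′ y Cc Cc′ (inj₁ ay)        (inj₂ (y∉F , _))  = ⊥-elim (y∉F (inside c Cc ay))
      disjoint′ c c′ y Cc Cc′ (inj₂ (y∉F , _)) (inj₁ a′y)        = ⊥-elim (y∉F (inside c′ Cc′ a′y))
      disjoint′ c c′ y Cc Cc′ (inj₂ (_ , gy))  (inj₂ (_ , g′y))  = subst (_≡ c′) gy g′y

      old⊥new : ∀ {c x y} → Aₓ c x → ¬ F y → g y ≡ c → x ⊥ y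
      old⊥new {x = x} {y} ax y∉F refl = proj₂ (g-incomparable y y∉F) x ax

      antichain′ : ∀ c → C c → Antichain (extendBy g c)
      antichain′ c Cc x y (inj₁ ax)        (inj₁ ay)        x≢y = antichain c Cc x y ax ay x≢y
      antichain′ c Cc x y (inj₁ ax)        (inj₂ (y∉F , gy)) _  = old⊥new ax y∉F gy
      antichain′ c Cc x y (inj₂ (x∉F , gx)) (inj₁ ay)        _  = ⊥-sym (old⊥new ay x∉F gx)
      antichain′ c Cc x y (inj₂ (x∉F , gx)) (inj₂ (y∉F , gy)) x≢y =
        ⊥-elim (x≢y (g-injective x y x∉F y∉F (subst (_≡ g y) (sym gx) (sym gy))))

mainTheorem10 : ExcludedMiddle (Level.suc 0ℓ) →
    {A : Set} (P : PosetOn A) → Countable A →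
    let open Order P in
    NoInfiniteAntichain →
    (F : Pred A 0ℓ) → StrongThickChain F →
    (C : Pred A 0ℓ) → MaximalChainIn C F →
    (Aₓ : A → Pred A 0ℓ) → AntichainPartition F C Aₓ →
    (∀ x → C x → Aₓ x x) →
    Σ (A → Pred A 0ℓ) λ B →
      AntichainPartition (λ _ → ⊤) C B × (∀ x → C x → Aₓ x ⊆ B x)
mainTheorem10 em P (enc , enc-injective) nia F strong C _ Aₓ AP _ =
  extendBy P AP choice ,
  extendBy-partition P AP (decide em) choice choice-good choice-injective ,
  λ _ _ → inj₁
  where
  open InjectiveChoice (decide em) enc enc-injective (λ y → ¬ F y) (IncomparableClass P AP)
         (fresh-IncomparableClass P AP (stable em) nia strong)
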